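{- Let $\{F(N)\}_{N\ge 0}$ be a family of series in $q$, let $a\ge 2$ be an integer, and let $k_1,\ldots,k_{a-1}$ be nonnegative integers. Then \begin{align*} &\sum_{N_1,\ldots N_a\ge 0}\frac{q^{\sum_{i=1}^{a-2} \binom{N_i+k_i}{2}+\binom{N_{a-1}+k_{a-1}}{2}+\binom{N_{a}+k_{a-1}+1}{2}}F(N_a)}{(q;q)_{N_1}}\begin{bmatrix}N_1\\ N_2\end{bmatrix}\cdots \begin{bmatrix}N_{a-1}\\ N_a\end{bmatrix}\\ &=\sum_{N_1,\ldots N_a\ge 0}\frac{q^{\sum_{i=1}^{a-2} \binom{N_i+k_i}{2}+\binom{N_{a-1}+k_{a-1}+1}{2}+\binom{N_{a}+k_{a-1}}{2}}F(N_a)}{(q;q)_{N_1}}\begin{bmatrix}N_1\\ N_2\end{bmatrix}\cdots \begin{bmatrix}N_{a-1}\\ N_a\end{bmatrix}\\ &\quad+\sum_{N_1,\ldots N_a\ge 0}\frac{q^{\sum_{i=1}^{a-2} \binom{N_i+k_i+1}{2}+\binom{N_{a-1}+k_{a-1}+1}{2}+\binom{N_{a}+k_{a-1}+1}{2}}F(N_a)}{(q;q)_{N_1}}\begin{bmatrix}N_1\\ N_2\end{bmatrix}\cdots \begin{bmatrix}N_{a-1}\\ N_a\end{bmatrix}. \end{align*}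
   Context: $(q;q)_n=\prod_{j=1}^{n}(1-q^j)$; $\begin{bmatrix} N\\ M\end{bmatrix}=\frac{(q;q)_N}{(q;q)_M(q;q)_{N-M}}$ for $0\le M\le N$ and $0$ otherwise. Identities are between series in $q$ (the sums assumed well defined). -}

module Defs where

open import Algebra.Bundles using (CommutativeRing)
open import Data.Nat as ℕ using (ℕ; zero; suc; _≤_; _≤?_; _∸_)
open import Data.Nat.Combinatorics using (_C_)
open import Data.Fin using (Fin; zero; suc; inject₁; fromℕ)
open import Data.Vec.Functional using (_∷_)
open import Data.List as List using (List; [])
open import Data.Product using (∃)
open import Relation.Nullary using (yes; no)

module PS {c ℓ} (R : CommutativeRing c ℓ) where
  open CommutativeRing R using (Carrier; _≈_; _+_; _*_; -_; 0#; 1#)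

  Series : Set c
  Series = ℕ → Carrier

  Σ≤ : ℕ → (ℕ → Carrier) → Carrier
  Σ≤ zero f = f 0
  Σ≤ (suc n) f = Σ≤ n f + f (suc n)

  0ₛ : Series
  0ₛ _ = 0#

  1ₛ : Series
  1ₛ zero = 1#
  1ₛ (suc _) = 0#

  _⊕_ : Series → Series → Series
  (f ⊕ g) n = f n + g n

  ⊖_ : Series → Series
  (⊖ f) n = - f n

  _⊗_ : Series → Series → Series
  (f ⊗ g) n = Σ≤ n (λ i → f i * g (n ∸ i))

  infixl 6 _⊕_
  infixl 7 _⊗_

  qpow : ℕ → Series
  qpow e n with e ℕ.≟ n
  ... | yes _ = 1#
  ... | no _ = 0#

  poch : ℕ → Series
  poch zero = 1ₛ
  poch (suc n) = poch n ⊗ (1ₛ ⊕ ⊖ qpow (suc n))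

  -- Multiplicative inverse of a series whose constant term is 1:
  -- g 0 = 1, g (n+1) = - Σ_{i=1}^{n+1} f i * g (n+1-i).
  -- invAux f n is the list [g n, g (n-1), ..., g 0].
  invAux : Series → ℕ → List Carrier
  invAux f zero = List._∷_ 1# []
  invAux f (suc n) = List._∷_ (- dot 1 (invAux f n)) (invAux f n)
    where
    dot : ℕ → List Carrier → Carrier
    dot i [] = 0#
    dot i (List._∷_ x xs) = f i * x + dot (suc i) xs

  headOr0 : List Carrier → Carrier
  headOr0 [] = 0#
  headOr0 (List._∷_ x _) = x

  -- 1/f for f with constant term 1 (only used for such f)
  inv1 : Series → Series
  inv1 f n = headOr0 (invAux f n)

  qbinom : ℕ → ℕ → Series
  qbinom N M with M ≤? N
  ... | yes _ = poch N ⊗ inv1 (poch M ⊗ poch (N ∸ M))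
  ... | no _ = 0ₛ

  ΠFin : ∀ n → (Fin n → Series) → Series
  ΠFin zero f = 1ₛ
  ΠFin (suc n) f = f zero ⊗ ΠFin n (λ i → f (suc i))

  boxSum : ∀ n → ℕ → ((Fin n → ℕ) → Series) → Series
  boxSum zero B f = f (λ ())
  boxSum (suc n) B f m = Σ≤ B (λ j → boxSum n B (λ N → f (j ∷ N)) m)

  -- S is the (q-adic / coefficientwise) sum of the family f:
  -- every coefficient of the box partial sums is eventually equal to that of S.
  IsSum : ∀ n → ((Fin n → ℕ) → Series) → Series → Set ℓ
  IsSum n f S = ∀ m → ∃ λ B → ∀ B′ → B ≤ B′ → boxSum n B′ f m ≈ S m

ΣFinℕ : ∀ n → (Fin n → ℕ) → ℕ
ΣFinℕ zero f = 0
ΣFinℕ (suc n) f = f zero ℕ.+ ΣFinℕ n (λ i → f (suc i))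

-- Here a = b + 2; indices are 0-based: N_i (1-based) = N (i-1), k_i = k (i-1).
-- Exponent  Σ_{i=1}^{a-2} C(N_i+k_i+e₀, 2) + C(N_{a-1}+k_{a-1}+e₁, 2) + C(N_a+k_{a-1}+e₂, 2)
expo : (b : ℕ) → (k : Fin (suc b) → ℕ) → (e₀ e₁ e₂ : ℕ) → (N : Fin (suc (suc b)) → ℕ) → ℕ
expo b k e₀ e₁ e₂ N =
  ΣFinℕ b (λ i → (N (inject₁ (inject₁ i)) ℕ.+ k (inject₁ i) ℕ.+ e₀) C 2)
  ℕ.+ ((N (inject₁ (fromℕ b)) ℕ.+ k (fromℕ b) ℕ.+ e₁) C 2)
  ℕ.+ ((N (fromℕ (suc b)) ℕ.+ k (fromℕ b) ℕ.+ e₂) C 2)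

module Terms {c ℓ} (R : CommutativeRing c ℓ) where
  open PS R

  term : (F : ℕ → Series) (b : ℕ) (k : Fin (suc b) → ℕ) (e₀ e₁ e₂ : ℕ) →
         (Fin (suc (suc b)) → ℕ) → Series
  term F b k e₀ e₁ e₂ N =
    qpow (expo b k e₀ e₁ e₂ N) ⊗ F (N (fromℕ (suc b))) ⊗ inv1 (poch (N zero))
      ⊗ ΠFin (suc b) (λ i → qbinom (N (inject₁ i)) (N (suc i)))

{-# OPTIONS --safe #-}
-- Put weight N = (q;q)_{N_1}^{-1} [N_1 N_2] ⋯ [N_{a-1} N_a] and let Δ N be the N-th summand of
-- the left-hand side minus that of the first sum on the right. Raising N_1, …, N_{a-1} by one
-- turns Δ into the N-th summand of the second sum on the right: since
-- (q;q)_{n+1} = (1 - q^{n+1}) (q;q)_n, the q-binomials telescope to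
-- weight N = (1 - q^{N_{a-1} - N_a + 1}) · weight (raised N), and C(y+1,2) = C(y,2) + y accounts
-- for the exponents. The raising map is a bijection onto the shifted summation range, and Δ
-- vanishes on its boundary faces N_i = 0 (i < a): either N_{a-1} ≤ N_a, where both summands
-- agree or contain a zero q-binomial, or some earlier N_j < N_{j+1} makes [N_j N_{j+1}] zero.
-- Far out in the box the summands do not reach a fixed power of q, so the identity holds
-- coefficientwise on all large boxes.
module Submission where

open import Defs
open import Algebra.Bundles using (CommutativeRing)
import Algebra.Construct.Pointwise as Pointwise
open import Data.Nat as ℕ using (ℕ; zero; suc; _≤_; _<_; _∸_; z≤n; s≤s)
  renaming (_+_ to _+ℕ_)
import Data.Nat.Properties as ℕₚ
open import Data.Nat.Combinatorics using (_C_; nCk+nC[k+1]≡[n+1]C[k+1]; nC1≡n)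
open import Data.Nat.Solver using (module +-*-Solver)
open import Data.Product using (∃; _,_; _×_; proj₁; proj₂)
open import Data.Bool using (Bool; true; false; if_then_else_)
open import Data.Fin using (Fin; zero; suc; inject₁; fromℕ)
open import Data.Sum using (_⊎_; inj₁; inj₂)
open import Data.Empty using (⊥-elim)
open import Relation.Nullary using (yes; no)
import Relation.Binary.PropositionalEquality as ≡
open ≡ using (_≡_; _≢_)
import Relation.Binary.Reasoning.Setoid as SetoidReasoning
import Algebra.Properties.Ring as RingProperties
import Algebra.Properties.Group

notLast : ∀ {n} → Fin (suc n) → Bool
notLast {zero}  zero    = false
notLast {suc n} zero    = true
notLast {suc n} (suc i) = notLast i

notLast-inject₁ : ∀ {n} (i : Fin n) → notLast (inject₁ i) ≡ true
notLast-inject₁ {suc n} zero    = ≡.refl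
notLast-inject₁ {suc n} (suc i) = notLast-inject₁ i

notLast-fromℕ : ∀ n → notLast (fromℕ n) ≡ false
notLast-fromℕ zero    = ≡.refl
notLast-fromℕ (suc n) = notLast-fromℕ n

notLast⇒inject₁ : ∀ {n} (i : Fin (suc n)) → notLast i ≡ true → ∃ λ j → inject₁ j ≡ i
notLast⇒inject₁ {suc n} zero    _ = zero , ≡.refl
notLast⇒inject₁ {suc n} (suc i) p with notLast⇒inject₁ i p
... | j , ≡.refl = suc j , ≡.refl

fromℕ-or-inject₁ : ∀ {n} (i : Fin (suc n)) → i ≡ fromℕ n ⊎ ∃ λ j → i ≡ inject₁ j
fromℕ-or-inject₁ {zero}  zero    = inj₁ ≡.refl
fromℕ-or-inject₁ {suc n} zero    = inj₂ (zero , ≡.refl)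
fromℕ-or-inject₁ {suc n} (suc i) with fromℕ-or-inject₁ i
... | inj₁ ≡.refl       = inj₁ ≡.refl
... | inj₂ (j , ≡.refl) = inj₂ (suc j , ≡.refl)

increment : ∀ {n} → (Fin n → Bool) → (Fin n → ℕ) → Fin n → ℕ
increment s N i = if s i then suc (N i) else N i

shiftInit : ∀ {n} → (Fin (suc n) → ℕ) → Fin (suc n) → ℕ
shiftInit = increment notLast

shiftInit-inject₁ : ∀ {n} (N : Fin (suc n) → ℕ) i → shiftInit N (inject₁ i) ≡ suc (N (inject₁ i))
shiftInit-inject₁ N i rewrite notLast-inject₁ i = ≡.refl

shiftInit-fromℕ : ∀ n (N : Fin (suc n) → ℕ) → shiftInit N (fromℕ n) ≡ N (fromℕ n)
shiftInit-fromℕ n N rewrite notLast-fromℕ n = ≡.refl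

ascent : ∀ n (N : Fin (suc n) → ℕ) i → N i < N (fromℕ n) → ∃ λ j → N (inject₁ j) < N (suc j)
ascent zero    N zero    Ni<Nn = ⊥-elim (ℕₚ.<-irrefl ≡.refl Ni<Nn)
ascent (suc n) N (suc i) Ni<Nn with ascent n (λ i → N (suc i)) i Ni<Nn
... | j , asc = suc j , asc
ascent (suc n) N zero    N0<Nn with N zero ℕ.<? N (suc zero)
... | yes asc = zero , asc
... | no N0≮N1 with ascent n (λ i → N (suc i)) zero (ℕₚ.≤-<-trans (ℕₚ.≮⇒≥ N0≮N1) N0<Nn)
...   | j , asc = suc j , asc

[1+n]C2≡n+nC2 : ∀ n → suc n C 2 ≡ n +ℕ n C 2
[1+n]C2≡n+nC2 n = ≡.trans (≡.sym (nCk+nC[k+1]≡[n+1]C[k+1] n 1)) (≡.cong (_+ℕ n C 2) (nC1≡n n))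

m<n⇒m≤nC2 : ∀ {m n} → m < n → m ≤ n C 2
m<n⇒m≤nC2 {m} {suc n} (s≤s m≤n) = ≡.subst (m ≤_) (≡.sym ([1+n]C2≡n+nC2 n)) (ℕₚ.m≤n⇒m≤n+o (n C 2) m≤n)

ΣFinℕ-cong : ∀ n {f g : Fin n → ℕ} → (∀ i → f i ≡ g i) → ΣFinℕ n f ≡ ΣFinℕ n g
ΣFinℕ-cong zero    f≡g = ≡.refl
ΣFinℕ-cong (suc n) f≡g = ≡.cong₂ _+ℕ_ (f≡g zero) (ΣFinℕ-cong n (λ i → f≡g (suc i)))

f≤ΣFinℕf : ∀ n (f : Fin n → ℕ) i → f i ≤ ΣFinℕ n f
f≤ΣFinℕf (suc n) f zero    = ℕₚ.m≤m+n (f zero) _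
f≤ΣFinℕf (suc n) f (suc i) = ℕₚ.m≤n⇒m≤o+n (f zero) (f≤ΣFinℕf n (λ i → f (suc i)) i)

module _ (b : ℕ) (k : Fin (suc b) → ℕ) where

  private
    penult last : Fin (suc (suc b))
    penult = inject₁ (fromℕ b)
    last   = fromℕ (suc b)

    initTerms : ℕ → (Fin (suc (suc b)) → ℕ) → Fin b → ℕ
    initTerms e₀ N i = (N (inject₁ (inject₁ i)) +ℕ k (inject₁ i) +ℕ e₀) C 2

    penultTerm lastTerm : ℕ → (Fin (suc (suc b)) → ℕ) → ℕ
    penultTerm e₁ N = (N penult +ℕ k (fromℕ b) +ℕ e₁) C 2
    lastTerm   e₂ N = (N last +ℕ k (fromℕ b) +ℕ e₂) C 2

  expo-cong : ∀ e₀ e₁ e₂ {N N′ : Fin (suc (suc b)) → ℕ} → (∀ i → N i ≡ N′ i) →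
              expo b k e₀ e₁ e₂ N ≡ expo b k e₀ e₁ e₂ N′
  expo-cong e₀ e₁ e₂ N≡N′ = ≡.cong₂ _+ℕ_
    (≡.cong₂ _+ℕ_ (ΣFinℕ-cong b (λ i → ≡.cong (λ x → (x +ℕ k (inject₁ i) +ℕ e₀) C 2)
                                               (N≡N′ (inject₁ (inject₁ i)))))
                  (≡.cong (λ x → (x +ℕ k (fromℕ b) +ℕ e₁) C 2) (N≡N′ penult)))
    (≡.cong (λ x → (x +ℕ k (fromℕ b) +ℕ e₂) C 2) (N≡N′ last))

  expo-shiftInit : ∀ e₀ e₁ e₂ N → expo b k e₀ e₁ e₂ (shiftInit N) ≡ expo b k (suc e₀) (suc e₁) e₂ N
  expo-shiftInit e₀ e₁ e₂ N = ≡.cong₂ _+ℕ_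
    (≡.cong₂ _+ℕ_ (ΣFinℕ-cong b (λ i → ≡.cong (_C 2) (shifted (inject₁ i) (k (inject₁ i)) e₀)))
                  (≡.cong (_C 2) (shifted (fromℕ b) (k (fromℕ b)) e₁)))
    (≡.cong (λ x → (x +ℕ k (fromℕ b) +ℕ e₂) C 2) (shiftInit-fromℕ (suc b) N))
    where
    shifted : ∀ i κ e → shiftInit N (inject₁ i) +ℕ κ +ℕ e ≡ N (inject₁ i) +ℕ κ +ℕ suc e
    shifted i κ e = ≡.trans (≡.cong (λ x → x +ℕ κ +ℕ e) (shiftInit-inject₁ N i))
                            (≡.sym (ℕₚ.+-suc (N (inject₁ i) +ℕ κ) e))

  -- Both sides reduce via C(y+1,2) = C(y,2) + y, and N_{a-1} + k_{a-1} = (N_a + k_{a-1}) + gap.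
  expo-gap : ∀ e₀ N → N last ≤ N penult → expo b k e₀ 1 0 N ≡ expo b k e₀ 0 1 N +ℕ (N penult ∸ N last)
  expo-gap e₀ N Nₗ≤Nₚ = begin
    X +ℕ (y +ℕ 1) C 2 +ℕ (x +ℕ 0) C 2
      ≡⟨ ≡.cong (λ z → X +ℕ (z +ℕ 1) C 2 +ℕ (x +ℕ 0) C 2) y≡d+x ⟩
    X +ℕ (d +ℕ x +ℕ 1) C 2 +ℕ (x +ℕ 0) C 2
      ≡⟨ gap-arith X x d ⟩
    X +ℕ (d +ℕ x +ℕ 0) C 2 +ℕ (x +ℕ 1) C 2 +ℕ d
      ≡⟨ ≡.cong (λ z → X +ℕ (z +ℕ 0) C 2 +ℕ (x +ℕ 1) C 2 +ℕ d) y≡d+x ⟨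
    X +ℕ (y +ℕ 0) C 2 +ℕ (x +ℕ 1) C 2 +ℕ d
      ∎
    where
    open ≡.≡-Reasoning
    X = ΣFinℕ b (initTerms e₀ N)
    x = N last +ℕ k (fromℕ b)
    y = N penult +ℕ k (fromℕ b)
    d = N penult ∸ N last
    y≡d+x : y ≡ d +ℕ x
    y≡d+x = ≡.trans (≡.cong (_+ℕ k (fromℕ b)) (≡.sym (ℕₚ.m∸n+n≡m Nₗ≤Nₚ)))
                    (ℕₚ.+-assoc d (N last) (k (fromℕ b)))
    gap-arith : ∀ X x d →
      X +ℕ (d +ℕ x +ℕ 1) C 2 +ℕ (x +ℕ 0) C 2 ≡ X +ℕ (d +ℕ x +ℕ 0) C 2 +ℕ (x +ℕ 1) C 2 +ℕ d
    gap-arith X x d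
      rewrite ℕₚ.+-identityʳ (d +ℕ x) | ℕₚ.+-identityʳ x | ℕₚ.+-comm (d +ℕ x) 1 | ℕₚ.+-comm x 1
            | [1+n]C2≡n+nC2 (d +ℕ x) | [1+n]C2≡n+nC2 x
      = solve 5 (λ X x d Y Z → X :+ (d :+ x :+ Y) :+ Z := X :+ Y :+ (x :+ Z) :+ d) ≡.refl X x d ((d +ℕ x) C 2) (x C 2)
      where open +-*-Solver

  expo-≥ : ∀ e₀ e₁ e₂ N {L} i → L < N (inject₁ i) → L ≤ expo b k e₀ e₁ e₂ N
  expo-≥ e₀ e₁ e₂ N i L<Nᵢ with fromℕ-or-inject₁ i
  ... | inj₁ ≡.refl =
    ℕₚ.≤-trans (m<n⇒m≤nC2 (ℕₚ.m≤n⇒m≤n+o e₁ (ℕₚ.m≤n⇒m≤n+o (k (fromℕ b)) L<Nᵢ)))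
    (ℕₚ.≤-trans (ℕₚ.m≤n+m (penultTerm e₁ N) (ΣFinℕ b (initTerms e₀ N)))
                (ℕₚ.m≤m+n _ (lastTerm e₂ N)))
  ... | inj₂ (j , ≡.refl) =
    ℕₚ.≤-trans (m<n⇒m≤nC2 (ℕₚ.m≤n⇒m≤n+o e₀ (ℕₚ.m≤n⇒m≤n+o (k (inject₁ j)) L<Nᵢ)))
    (ℕₚ.≤-trans (f≤ΣFinℕf b (initTerms e₀ N) j)
    (ℕₚ.≤-trans (ℕₚ.m≤m+n (ΣFinℕ b (initTerms e₀ N)) (penultTerm e₁ N))
                (ℕₚ.m≤m+n _ (lastTerm e₂ N))))

module SeriesRing {c ℓ} (R : CommutativeRing c ℓ) where
  open PS R
  open CommutativeRing R hiding (zero)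
  open SetoidReasoning setoid
  open import Algebra.Properties.CommutativeSemigroup +-commutativeSemigroup using (interchange)

  Σ≤-cong : ∀ n {f g : ℕ → Carrier} → (∀ i → i ≤ n → f i ≈ g i) → Σ≤ n f ≈ Σ≤ n g
  Σ≤-cong zero    f≈g = f≈g 0 z≤n
  Σ≤-cong (suc n) f≈g =
    +-cong (Σ≤-cong n (λ i i≤n → f≈g i (ℕₚ.m≤n⇒m≤1+n i≤n))) (f≈g (suc n) ℕₚ.≤-refl)

  Σ≤-zero : ∀ n {f : ℕ → Carrier} → (∀ i → i ≤ n → f i ≈ 0#) → Σ≤ n f ≈ 0#
  Σ≤-zero n f≈0 = trans (Σ≤-cong n f≈0) (Σ≤-const0 n)
    where
    Σ≤-const0 : ∀ n → Σ≤ n (λ _ → 0#) ≈ 0#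
    Σ≤-const0 zero    = refl
    Σ≤-const0 (suc n) = trans (+-identityʳ _) (Σ≤-const0 n)

  Σ≤-+ : ∀ n (f g : ℕ → Carrier) → Σ≤ n (λ i → f i + g i) ≈ Σ≤ n f + Σ≤ n g
  Σ≤-+ zero    f g = refl
  Σ≤-+ (suc n) f g = trans (+-congʳ (Σ≤-+ n f g)) (interchange _ _ _ _)

  *-distribˡ-Σ≤ : ∀ n a (f : ℕ → Carrier) → a * Σ≤ n f ≈ Σ≤ n (λ i → a * f i)
  *-distribˡ-Σ≤ zero    a f = refl
  *-distribˡ-Σ≤ (suc n) a f = trans (distribˡ a _ _) (+-congʳ (*-distribˡ-Σ≤ n a f))

  *-distribʳ-Σ≤ : ∀ n a (f : ℕ → Carrier) → Σ≤ n f * a ≈ Σ≤ n (λ i → f i * a)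
  *-distribʳ-Σ≤ zero    a f = refl
  *-distribʳ-Σ≤ (suc n) a f = trans (distribʳ a _ _) (+-congʳ (*-distribʳ-Σ≤ n a f))

  Σ≤-head : ∀ n (f : ℕ → Carrier) → Σ≤ (suc n) f ≈ f 0 + Σ≤ n (λ i → f (suc i))
  Σ≤-head zero    f = refl
  Σ≤-head (suc n) f = trans (+-congʳ (Σ≤-head n f)) (+-assoc _ _ _)

  Σ≤-reverse : ∀ n (f : ℕ → Carrier) → Σ≤ n f ≈ Σ≤ n (λ i → f (n ∸ i))
  Σ≤-reverse zero    f = refl
  Σ≤-reverse (suc n) f = begin
    Σ≤ (suc n) f                                  ≈⟨ trans (Σ≤-head n f) (+-comm _ _) ⟩
    Σ≤ n (λ i → f (suc i)) + f 0                  ≈⟨ +-congʳ (Σ≤-reverse n (λ i → f (suc i))) ⟩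
    Σ≤ n (λ i → f (suc (n ∸ i))) + f 0            ≈⟨ +-cong (Σ≤-cong n (λ i i≤n →
                                                       reflexive (≡.cong f (≡.sym (ℕₚ.+-∸-assoc 1 i≤n)))))
                                                     (reflexive (≡.cong f (≡.sym (ℕₚ.n∸n≡0 n)))) ⟩
    Σ≤ (suc n) (λ i → f (suc n ∸ i))              ∎

  Σ≤-exchange : ∀ n (h : ℕ → ℕ → Carrier) →
                Σ≤ n (λ i → Σ≤ i (h i)) ≈ Σ≤ n (λ j → Σ≤ (n ∸ j) (λ l → h (j +ℕ l) j))
  Σ≤-exchange zero    h = refl
  Σ≤-exchange (suc n) h = begin
    Σ≤ n (λ i → Σ≤ i (h i)) + (Σ≤ n (h (suc n)) + h (suc n) (suc n))
      ≈⟨ trans (+-congʳ (Σ≤-exchange n h)) (sym (+-assoc _ _ _)) ⟩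
    (Σ≤ n (λ j → Σ≤ (n ∸ j) (λ l → h (j +ℕ l) j)) + Σ≤ n (h (suc n))) + h (suc n) (suc n)
      ≈⟨ +-cong (sym (Σ≤-+ n _ _)) (reflexive (≡.cong (λ x → h x (suc n)) (≡.sym (ℕₚ.+-identityʳ (suc n))))) ⟩
    Σ≤ n (λ j → Σ≤ (n ∸ j) (λ l → h (j +ℕ l) j) + h (suc n) j) + h (suc n +ℕ 0) (suc n)
      ≈⟨ +-cong (Σ≤-cong n extend)
                (reflexive (≡.cong (λ m → Σ≤ m (λ l → h (suc n +ℕ l) (suc n))) (≡.sym (ℕₚ.n∸n≡0 n)))) ⟩
    Σ≤ n (λ j → Σ≤ (suc n ∸ j) (λ l → h (j +ℕ l) j)) + Σ≤ (suc n ∸ suc n) (λ l → h (suc n +ℕ l) (suc n))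
      ∎
    where
    extend : ∀ j → j ≤ n →
             Σ≤ (n ∸ j) (λ l → h (j +ℕ l) j) + h (suc n) j ≈ Σ≤ (suc n ∸ j) (λ l → h (j +ℕ l) j)
    extend j j≤n rewrite ℕₚ.+-∸-assoc 1 j≤n = +-congˡ (reflexive (≡.cong (λ x → h x j)
      (≡.sym (≡.trans (ℕₚ.+-suc j (n ∸ j)) (≡.cong suc (ℕₚ.m+[n∸m]≡n j≤n))))))

  infix 4 _≈ₛ_
  _≈ₛ_ : Series → Series → Set ℓ
  f ≈ₛ g = ∀ n → f n ≈ g n

  ⊗-cong : ∀ {f f′ g g′} → f ≈ₛ f′ → g ≈ₛ g′ → f ⊗ g ≈ₛ f′ ⊗ g′
  ⊗-cong f≈f′ g≈g′ n = Σ≤-cong n (λ i _ → *-cong (f≈f′ i) (g≈g′ (n ∸ i)))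

  ⊗-comm : ∀ f g → f ⊗ g ≈ₛ g ⊗ f
  ⊗-comm f g n = trans (Σ≤-reverse n _) (Σ≤-cong n (λ i i≤n →
    trans (*-comm _ _) (*-congʳ (reflexive (≡.cong g (ℕₚ.m∸[m∸n]≡n i≤n))))))

  ⊗-assoc : ∀ f g h → (f ⊗ g) ⊗ h ≈ₛ f ⊗ (g ⊗ h)
  ⊗-assoc f g h n = begin
    Σ≤ n (λ i → Σ≤ i (λ j → f j * g (i ∸ j)) * h (n ∸ i))
      ≈⟨ Σ≤-cong n (λ i _ → *-distribʳ-Σ≤ i _ _) ⟩
    Σ≤ n (λ i → Σ≤ i (λ j → f j * g (i ∸ j) * h (n ∸ i)))
      ≈⟨ Σ≤-exchange n (λ i j → f j * g (i ∸ j) * h (n ∸ i)) ⟩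
    Σ≤ n (λ j → Σ≤ (n ∸ j) (λ l → f j * g (j +ℕ l ∸ j) * h (n ∸ (j +ℕ l))))
      ≈⟨ Σ≤-cong n (λ j _ → Σ≤-cong (n ∸ j) (λ l _ → trans (*-assoc _ _ _) (*-congˡ (*-cong
           (reflexive (≡.cong g (ℕₚ.m+n∸m≡n j l)))
           (reflexive (≡.cong h (≡.sym (ℕₚ.∸-+-assoc n j l)))))))) ⟩
    Σ≤ n (λ j → Σ≤ (n ∸ j) (λ l → f j * (g l * h (n ∸ j ∸ l))))
      ≈⟨ Σ≤-cong n (λ j _ → sym (*-distribˡ-Σ≤ (n ∸ j) _ _)) ⟩
    Σ≤ n (λ j → f j * Σ≤ (n ∸ j) (λ l → g l * h (n ∸ j ∸ l)))
      ∎

  ⊗-identityˡ : ∀ f → 1ₛ ⊗ f ≈ₛ f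
  ⊗-identityˡ f zero    = *-identityˡ _
  ⊗-identityˡ f (suc n) = begin
    Σ≤ (suc n) (λ i → 1ₛ i * f (suc n ∸ i))      ≈⟨ Σ≤-head n _ ⟩
    1# * f (suc n) + Σ≤ n (λ i → 0# * f (n ∸ i)) ≈⟨ +-cong (*-identityˡ _) (Σ≤-zero n (λ i _ → zeroˡ _)) ⟩
    f (suc n) + 0#                               ≈⟨ +-identityʳ _ ⟩
    f (suc n)                                    ∎

  ⊗-identityʳ : ∀ f → f ⊗ 1ₛ ≈ₛ f
  ⊗-identityʳ f n = trans (⊗-comm f 1ₛ n) (⊗-identityˡ f n)

  ⊗-distribˡ : ∀ h f g → h ⊗ (f ⊕ g) ≈ₛ h ⊗ f ⊕ h ⊗ g
  ⊗-distribˡ h f g n = trans (Σ≤-cong n (λ i _ → distribˡ _ _ _)) (Σ≤-+ n _ _)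

  ⊗-distribʳ : ∀ h f g → (f ⊕ g) ⊗ h ≈ₛ f ⊗ h ⊕ g ⊗ h
  ⊗-distribʳ h f g n = trans (Σ≤-cong n (λ i _ → distribʳ _ _ _)) (Σ≤-+ n _ _)

  series : CommutativeRing c ℓ
  series = record
    { Carrier = Series
    ; _≈_ = _≈ₛ_
    ; _+_ = _⊕_
    ; _*_ = _⊗_
    ; -_ = ⊖_
    ; 0# = 0ₛ
    ; 1# = 1ₛ
    ; isCommutativeRing = record
      { isRing = record
        { +-isAbelianGroup = Pointwise.isAbelianGroup ℕ +-isAbelianGroup
        ; *-cong = ⊗-cong
        ; *-assoc = ⊗-assoc
        ; *-identity = ⊗-identityˡ , ⊗-identityʳ
        ; distrib = ⊗-distribˡ , ⊗-distribʳ
        }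
      ; *-comm = ⊗-comm
      }
    }

module Monomials {c ℓ} (R : CommutativeRing c ℓ) where
  open PS R
  open CommutativeRing R hiding (zero)
  open SeriesRing R using (_≈ₛ_; Σ≤-zero)

  qpow-resp : ∀ {e n e′ n′} → (e ≡ n → e′ ≡ n′) → (e′ ≡ n′ → e ≡ n) → qpow e n ≈ qpow e′ n′
  qpow-resp {e} {n} {e′} {n′} to from with e ℕ.≟ n | e′ ℕ.≟ n′
  ... | yes _  | yes _  = refl
  ... | yes p  | no ¬q  = ⊥-elim (¬q (to p))
  ... | no ¬p  | yes q  = ⊥-elim (¬p (from q))
  ... | no _   | no _   = refl

  qpow-≢ : ∀ {e n} → e ≢ n → qpow e n ≈ 0#
  qpow-≢ {e} {n} e≢n with e ℕ.≟ n
  ... | yes e≡n = ⊥-elim (e≢n e≡n)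
  ... | no _    = refl

  qpow-diag : ∀ e → qpow e e ≈ 1#
  qpow-diag e with e ℕ.≟ e
  ... | yes _   = refl
  ... | no e≢e  = ⊥-elim (e≢e ≡.refl)

  Σ≤-qpow-< : ∀ n e (g : ℕ → Carrier) → n < e → Σ≤ n (λ i → qpow e i * g i) ≈ 0#
  Σ≤-qpow-< n e g n<e = Σ≤-zero n (λ i i≤n →
    trans (*-congʳ (qpow-≢ (λ e≡i → ℕₚ.<-irrefl (≡.sym e≡i) (ℕₚ.≤-<-trans i≤n n<e)))) (zeroˡ _))

  Σ≤-qpow : ∀ n e (g : ℕ → Carrier) → e ≤ n → Σ≤ n (λ i → qpow e i * g i) ≈ g e
  Σ≤-qpow zero    .zero g z≤n = *-identityˡ _
  Σ≤-qpow (suc n) e     g e≤1+n with e ℕ.≤? n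
  ... | yes e≤n = trans (+-cong (Σ≤-qpow n e g e≤n)
                                (trans (*-congʳ (qpow-≢ (λ e≡1+n → ℕₚ.<-irrefl e≡1+n (s≤s e≤n)))) (zeroˡ _)))
                        (+-identityʳ _)
  ... | no e≰n rewrite ℕₚ.≤-antisym e≤1+n (ℕₚ.≰⇒> e≰n)
                = trans (+-cong (Σ≤-qpow-< n (suc n) g ℕₚ.≤-refl) (*-congʳ (qpow-diag (suc n))))
                        (trans (+-identityˡ _) (*-identityˡ _))

  qpow-⊗-≥ : ∀ e f n → e ≤ n → (qpow e ⊗ f) n ≈ f (n ∸ e)
  qpow-⊗-≥ e f n = Σ≤-qpow n e (λ i → f (n ∸ i))

  qpow-⊗-< : ∀ e f n → n < e → (qpow e ⊗ f) n ≈ 0#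
  qpow-⊗-< e f n = Σ≤-qpow-< n e (λ i → f (n ∸ i))

  qpow-+ : ∀ a b → qpow (a +ℕ b) ≈ₛ qpow a ⊗ qpow b
  qpow-+ a b n with a ℕ.≤? n
  ... | yes a≤n = sym (trans (qpow-⊗-≥ a (qpow b) n a≤n) (qpow-resp
          (λ b≡n∸a → ≡.trans (≡.cong (a +ℕ_) b≡n∸a) (ℕₚ.m+[n∸m]≡n a≤n))
          (λ a+b≡n → ≡.trans (≡.sym (ℕₚ.m+n∸m≡n a b)) (≡.cong (_∸ a) a+b≡n))))
  ... | no a≰n  = trans (qpow-≢ (λ a+b≡n → a≰n (≡.subst (a ≤_) a+b≡n (ℕₚ.m≤m+n a b))))
                        (sym (qpow-⊗-< a (qpow b) n (ℕₚ.≰⇒> a≰n)))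

module Inverses {c ℓ} (R : CommutativeRing c ℓ) where
  open import Data.List using (List; []; _∷_)
  open PS R
  open CommutativeRing R hiding (zero)
  open SeriesRing R using (_≈ₛ_; Σ≤-cong; Σ≤-head)
  open SetoidReasoning setoid

  -- A record rather than the bare f 0 ≈ 1#, so that f can be inferred from a proof of it.
  record ConstTermOne (f : Series) : Set ℓ where
    constructor constTermOne
    field constTerm≈1 : f 0 ≈ 1#

  ⊗-constTermOne : ∀ {f g} → ConstTermOne f → ConstTermOne g → ConstTermOne (f ⊗ g)
  ⊗-constTermOne (constTermOne f₀) (constTermOne g₀) = constTermOne (trans (*-cong f₀ g₀) (*-identityˡ 1#))

  dotFrom : Series → ℕ → List Carrier → Carrier
  dotFrom f i []       = 0#
  dotFrom f i (x ∷ xs) = f i * x + dotFrom f (suc i) xs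

  dotFrom-unique : ∀ f (d : ℕ → List Carrier → Carrier) → (∀ i → d i [] ≡ 0#) →
                   (∀ i x xs → d i (x ∷ xs) ≡ f i * x + d (suc i) xs) →
                   ∀ i xs → d i xs ≡ dotFrom f i xs
  dotFrom-unique f d d[] d∷ i []       = d[] i
  dotFrom-unique f d d[] d∷ i (x ∷ xs) =
    ≡.trans (d∷ i x xs) (≡.cong (f i * x +_) (dotFrom-unique f d d[] d∷ (suc i) xs))

  -- The dot product used by invAux is local to its where block; it is reached by
  -- unification, after abstracting its arguments so that they become variables.
  inv1-suc : ∀ f n → inv1 f (suc n) ≡ - dotFrom f 1 (invAux f n)
  inv1-suc f n with invAux f n | 1 | dotFrom-unique f _ (λ _ → ≡.refl) (λ _ _ _ → ≡.refl)
  ... | xs | i | dot≡dotFrom = ≡.cong -_ (dot≡dotFrom i xs)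

  dotFrom-invAux : ∀ f n i → dotFrom f i (invAux f n) ≈ Σ≤ n (λ t → f (i +ℕ t) * inv1 f (n ∸ t))
  dotFrom-invAux f zero    i = trans (+-identityʳ _) (*-congʳ (reflexive (≡.cong f (≡.sym (ℕₚ.+-identityʳ i)))))
  dotFrom-invAux f (suc n) i = begin
    f i * inv1 f (suc n) + dotFrom f (suc i) (invAux f n)
      ≈⟨ +-cong (*-congʳ (reflexive (≡.cong f (≡.sym (ℕₚ.+-identityʳ i))))) (dotFrom-invAux f n (suc i)) ⟩
    f (i +ℕ 0) * inv1 f (suc n) + Σ≤ n (λ t → f (suc i +ℕ t) * inv1 f (n ∸ t))
      ≈⟨ +-congˡ (Σ≤-cong n (λ t _ → *-congʳ (reflexive (≡.cong f (≡.sym (ℕₚ.+-suc i t)))))) ⟩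
    f (i +ℕ 0) * inv1 f (suc n) + Σ≤ n (λ t → f (i +ℕ suc t) * inv1 f (n ∸ t))
      ≈⟨ Σ≤-head n _ ⟨
    Σ≤ (suc n) (λ t → f (i +ℕ t) * inv1 f (suc n ∸ t))
      ∎

  inv1-inverseʳ : ∀ {f} → ConstTermOne f → f ⊗ inv1 f ≈ₛ 1ₛ
  inv1-inverseʳ (constTermOne f₀) zero    = trans (*-identityʳ _) f₀
  inv1-inverseʳ {f} (constTermOne f₀) (suc n) = begin
    Σ≤ (suc n) (λ i → f i * inv1 f (suc n ∸ i))
      ≈⟨ Σ≤-head n _ ⟩
    f 0 * inv1 f (suc n) + Σ≤ n (λ i → f (suc i) * inv1 f (n ∸ i))
      ≈⟨ +-cong (*-cong f₀ (reflexive (inv1-suc f n))) (sym (dotFrom-invAux f n 1)) ⟩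
    1# * (- dotFrom f 1 (invAux f n)) + dotFrom f 1 (invAux f n)
      ≈⟨ trans (+-congʳ (*-identityˡ _)) (-‿inverseˡ _) ⟩
    0#
      ∎

module QSeries {c ℓ} (R : CommutativeRing c ℓ) where
  open PS R
  open SeriesRing R using (series)
  open Monomials R using (qpow-≢)
  open Inverses R using (ConstTermOne; constTermOne; ⊗-constTermOne; inv1-inverseʳ)
  open CommutativeRing series hiding (zero)
  open import Algebra.Properties.CommutativeSemigroup *-commutativeSemigroup
    using (interchange; xy∙z≈xz∙y; x∙yz≈y∙xz; x∙yz≈xz∙y)
  open SetoidReasoning setoid
  module ℛ = CommutativeRing R

  inv1-inverseˡ : ∀ {f} → ConstTermOne f → inv1 f ⊗ f ≈ 1ₛ
  inv1-inverseˡ {f} f₀ = trans (*-comm (inv1 f) f) (inv1-inverseʳ f₀)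

  inv1-unique : ∀ {f} x → ConstTermOne f → x ⊗ f ≈ 1ₛ → x ≈ inv1 f
  inv1-unique {f} x f₀ xf≈1 = begin
    x                    ≈⟨ *-identityʳ x ⟨
    x ⊗ 1ₛ               ≈⟨ *-congˡ (inv1-inverseʳ f₀) ⟨
    x ⊗ (f ⊗ inv1 f)     ≈⟨ *-assoc x f (inv1 f) ⟨
    (x ⊗ f) ⊗ inv1 f     ≈⟨ *-congʳ {inv1 f} xf≈1 ⟩
    1ₛ ⊗ inv1 f          ≈⟨ *-identityˡ (inv1 f) ⟩
    inv1 f               ∎

  inv1-⊗ : ∀ {f g} → ConstTermOne f → ConstTermOne g → inv1 (f ⊗ g) ≈ inv1 f ⊗ inv1 g
  inv1-⊗ {f} {g} f₀ g₀ = sym (inv1-unique (inv1 f ⊗ inv1 g) (⊗-constTermOne f₀ g₀) (begin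
    (inv1 f ⊗ inv1 g) ⊗ (f ⊗ g)  ≈⟨ interchange (inv1 f) (inv1 g) f g ⟩
    (inv1 f ⊗ f) ⊗ (inv1 g ⊗ g)  ≈⟨ *-cong (inv1-inverseˡ f₀) (inv1-inverseˡ g₀) ⟩
    1ₛ ⊗ 1ₛ                      ≈⟨ *-identityˡ 1ₛ ⟩
    1ₛ                           ∎))

  1-q^_ : ℕ → Series
  1-q^ j = 1ₛ ⊕ ⊖ qpow j

  1-q^-constTermOne : ∀ j → ConstTermOne (1-q^ suc j)
  1-q^-constTermOne j = constTermOne (ℛ.trans
    (ℛ.+-congˡ (ℛ.trans (ℛ.-‿cong (qpow-≢ {suc j} {0} λ ())) (RingProperties.-0#≈0# ℛ.ring)))
    (ℛ.+-identityʳ ℛ.1#))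

  poch-constTermOne : ∀ n → ConstTermOne (poch n)
  poch-constTermOne zero    = constTermOne ℛ.refl
  poch-constTermOne (suc n) = ⊗-constTermOne (poch-constTermOne n) (1-q^-constTermOne n)

  inv1-poch-suc : ∀ n → inv1 (poch (suc n)) ⊗ 1-q^ suc n ≈ inv1 (poch n)
  inv1-poch-suc n = begin
    inv1 (poch n ⊗ w) ⊗ w          ≈⟨ *-congʳ {w} (inv1-⊗ (poch-constTermOne n) (1-q^-constTermOne n)) ⟩
    (inv1 (poch n) ⊗ inv1 w) ⊗ w   ≈⟨ *-assoc (inv1 (poch n)) (inv1 w) w ⟩
    inv1 (poch n) ⊗ (inv1 w ⊗ w)   ≈⟨ *-congˡ {inv1 (poch n)} (inv1-inverseˡ (1-q^-constTermOne n)) ⟩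
    inv1 (poch n) ⊗ 1ₛ             ≈⟨ *-identityʳ (inv1 (poch n)) ⟩
    inv1 (poch n)                  ∎
    where w = 1-q^ suc n

  qbinom-≤ : ∀ {A B} → B ≤ A → qbinom A B ≈ (poch A ⊗ inv1 (poch B)) ⊗ inv1 (poch (A ∸ B))
  qbinom-≤ {A} {B} B≤A with B ℕ.≤? A
  ... | yes _   = trans (*-congˡ {poch A} (inv1-⊗ (poch-constTermOne B) (poch-constTermOne (A ∸ B))))
                        (sym (*-assoc (poch A) (inv1 (poch B)) (inv1 (poch (A ∸ B)))))
  ... | no B≰A  = ⊥-elim (B≰A B≤A)

  qbinom-> : ∀ {A B} → A < B → qbinom A B ≈ 0ₛ
  qbinom-> {A} {B} A<B with B ℕ.≤? A
  ... | yes B≤A = ⊥-elim (ℕₚ.<-irrefl ≡.refl (ℕₚ.<-≤-trans A<B B≤A))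
  ... | no _    = refl

  -- q-analogue of (A+1 choose B+1)·(B+1) = (A choose B)·(A+1)
  qbinom-suc-suc : ∀ A B → qbinom (suc A) (suc B) ⊗ 1-q^ suc B ≈ qbinom A B ⊗ 1-q^ suc A
  qbinom-suc-suc A B with ℕₚ.≤-<-connex B A
  ... | inj₂ A<B = trans (vanishes (1-q^ suc B) (s≤s A<B)) (sym (vanishes (1-q^ suc A) A<B))
    where
    vanishes : ∀ {A B} f → A < B → qbinom A B ⊗ f ≈ 0ₛ
    vanishes f A<B = trans (*-congʳ {f} (qbinom-> A<B)) (zeroˡ f)
  ... | inj₁ B≤A = begin
    qbinom (suc A) (suc B) ⊗ w                   ≈⟨ *-congʳ {w} (qbinom-≤ (s≤s B≤A)) ⟩
    (((pA ⊗ u) ⊗ I′) ⊗ J) ⊗ w                     ≈⟨ xy∙z≈xz∙y ((pA ⊗ u) ⊗ I′) J w ⟩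
    (((pA ⊗ u) ⊗ I′) ⊗ w) ⊗ J                     ≈⟨ *-congʳ {J} (*-assoc (pA ⊗ u) I′ w) ⟩
    ((pA ⊗ u) ⊗ (I′ ⊗ w)) ⊗ J                     ≈⟨ *-congʳ {J} (*-congˡ {pA ⊗ u} (inv1-poch-suc B)) ⟩
    ((pA ⊗ u) ⊗ I) ⊗ J                            ≈⟨ *-congʳ {J} (xy∙z≈xz∙y pA u I) ⟩
    ((pA ⊗ I) ⊗ u) ⊗ J                            ≈⟨ xy∙z≈xz∙y (pA ⊗ I) u J ⟩
    ((pA ⊗ I) ⊗ J) ⊗ u                            ≈⟨ *-congʳ {u} (qbinom-≤ B≤A) ⟨
    qbinom A B ⊗ u                               ∎
    where
    pA = poch A
    u  = 1-q^ suc A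
    w  = 1-q^ suc B
    I′ = inv1 (poch (suc B))
    I  = inv1 (poch B)
    J  = inv1 (poch (A ∸ B))

  -- q-analogue of (A+1 choose B)·(A+1-B) = (A choose B)·(A+1)
  qbinom-sucˡ : ∀ {A B} → B ≤ A → qbinom (suc A) B ⊗ 1-q^ suc (A ∸ B) ≈ qbinom A B ⊗ 1-q^ suc A
  qbinom-sucˡ {A} {B} B≤A = begin
    qbinom (suc A) B ⊗ w                         ≈⟨ *-congʳ {w} (qbinom-≤ (ℕₚ.m≤n⇒m≤1+n B≤A)) ⟩
    ((pA ⊗ u) ⊗ I) ⊗ inv1 (poch (suc A ∸ B)) ⊗ w  ≡⟨ ≡.cong (λ m → ((pA ⊗ u) ⊗ I) ⊗ inv1 (poch m) ⊗ w)
                                                             (ℕₚ.+-∸-assoc 1 B≤A) ⟩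
    ((pA ⊗ u) ⊗ I) ⊗ J′ ⊗ w                       ≈⟨ *-assoc ((pA ⊗ u) ⊗ I) J′ w ⟩
    ((pA ⊗ u) ⊗ I) ⊗ (J′ ⊗ w)                     ≈⟨ *-congˡ {(pA ⊗ u) ⊗ I} (inv1-poch-suc (A ∸ B)) ⟩
    ((pA ⊗ u) ⊗ I) ⊗ J                            ≈⟨ *-congʳ {J} (xy∙z≈xz∙y pA u I) ⟩
    ((pA ⊗ I) ⊗ u) ⊗ J                            ≈⟨ xy∙z≈xz∙y (pA ⊗ I) u J ⟩
    ((pA ⊗ I) ⊗ J) ⊗ u                            ≈⟨ *-congʳ {u} (qbinom-≤ B≤A) ⟨
    qbinom A B ⊗ u                               ∎
    where
    pA = poch A
    u  = 1-q^ suc A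
    w  = 1-q^ suc (A ∸ B)
    I  = inv1 (poch B)
    J′ = inv1 (poch (suc (A ∸ B)))
    J  = inv1 (poch (A ∸ B))

  ΠFin-cong : ∀ n {f g : Fin n → Series} → (∀ i → f i ≈ g i) → ΠFin n f ≈ ΠFin n g
  ΠFin-cong zero    f≈g = refl
  ΠFin-cong (suc n) f≈g = *-cong (f≈g zero) (ΠFin-cong n (λ i → f≈g (suc i)))

  ΠFin-zero : ∀ n (f : Fin n → Series) i → f i ≈ 0ₛ → ΠFin n f ≈ 0ₛ
  ΠFin-zero (suc n) f zero    f₀≈0 = trans (*-congʳ {Π′} f₀≈0) (zeroˡ Π′)
    where Π′ = ΠFin n (λ i → f (suc i))
  ΠFin-zero (suc n) f (suc i) fᵢ≈0 =
    trans (*-congˡ {f zero} (ΠFin-zero n (λ i → f (suc i)) i fᵢ≈0)) (zeroʳ (f zero))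

  Πqbinom : ∀ n → (Fin (suc (suc n)) → ℕ) → Series
  Πqbinom n N = ΠFin (suc n) (λ i → qbinom (N (inject₁ i)) (N (suc i)))

  -- The factors 1 - q^{N_i + 1} produced by qbinom-suc-suc cancel along the chain,
  -- leaving only the first one and the last gap.
  Πqbinom-shiftInit : ∀ n (N : Fin (suc (suc n)) → ℕ) → N (fromℕ (suc n)) ≤ N (inject₁ (fromℕ n)) →
    1-q^ suc (N (inject₁ (fromℕ n)) ∸ N (fromℕ (suc n))) ⊗ Πqbinom n (shiftInit N) ≈ Πqbinom n N ⊗ 1-q^ suc (N zero)
  Πqbinom-shiftInit zero N N₁≤N₀ = begin
    w ⊗ (qbinom (suc N₀) N₁ ⊗ 1ₛ)   ≈⟨ *-congˡ {w} (*-identityʳ (qbinom (suc N₀) N₁)) ⟩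
    w ⊗ qbinom (suc N₀) N₁          ≈⟨ *-comm w (qbinom (suc N₀) N₁) ⟩
    qbinom (suc N₀) N₁ ⊗ w          ≈⟨ qbinom-sucˡ N₁≤N₀ ⟩
    qbinom N₀ N₁ ⊗ 1-q^ suc N₀      ≈⟨ *-congʳ {1-q^ suc N₀} (*-identityʳ (qbinom N₀ N₁)) ⟨
    (qbinom N₀ N₁ ⊗ 1ₛ) ⊗ 1-q^ suc N₀ ∎
    where
    N₀ = N zero
    N₁ = N (suc zero)
    w  = 1-q^ suc (N₀ ∸ N₁)
  Πqbinom-shiftInit (suc n) N Nₗ≤Nₚ = begin
    w ⊗ (Q′ ⊗ P′)                ≈⟨ x∙yz≈y∙xz w Q′ P′ ⟩
    Q′ ⊗ (w ⊗ P′)                ≈⟨ *-congˡ {Q′} (Πqbinom-shiftInit n (λ i → N (suc i)) Nₗ≤Nₚ) ⟩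
    Q′ ⊗ (P ⊗ 1-q^ suc N₁)       ≈⟨ x∙yz≈xz∙y Q′ P (1-q^ suc N₁) ⟩
    (Q′ ⊗ 1-q^ suc N₁) ⊗ P       ≈⟨ *-congʳ {P} (qbinom-suc-suc N₀ N₁) ⟩
    (Q ⊗ 1-q^ suc N₀) ⊗ P        ≈⟨ xy∙z≈xz∙y Q (1-q^ suc N₀) P ⟩
    (Q ⊗ P) ⊗ 1-q^ suc N₀        ∎
    where
    N₀ = N zero
    N₁ = N (suc zero)
    w  = 1-q^ suc (N (inject₁ (fromℕ (suc n))) ∸ N (fromℕ (suc (suc n))))
    Q′ = qbinom (suc N₀) (suc N₁)
    Q  = qbinom N₀ N₁
    P′ = Πqbinom n (shiftInit (λ i → N (suc i)))
    P  = Πqbinom n (λ i → N (suc i))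

  weight : ∀ n → (Fin (suc (suc n)) → ℕ) → Series
  weight n N = inv1 (poch (N zero)) ⊗ Πqbinom n N

  weight-shiftInit : ∀ n (N : Fin (suc (suc n)) → ℕ) → N (fromℕ (suc n)) ≤ N (inject₁ (fromℕ n)) →
    weight n N ≈ 1-q^ suc (N (inject₁ (fromℕ n)) ∸ N (fromℕ (suc n))) ⊗ weight n (shiftInit N)
  weight-shiftInit n N Nₗ≤Nₚ = sym (begin
    w ⊗ (I′ ⊗ Πqbinom n (shiftInit N))    ≈⟨ x∙yz≈y∙xz w I′ (Πqbinom n (shiftInit N)) ⟩
    I′ ⊗ (w ⊗ Πqbinom n (shiftInit N))    ≈⟨ *-congˡ {I′} (Πqbinom-shiftInit n N Nₗ≤Nₚ) ⟩
    I′ ⊗ (Πqbinom n N ⊗ 1-q^ suc (N zero)) ≈⟨ x∙yz≈xz∙y I′ (Πqbinom n N) (1-q^ suc (N zero)) ⟩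
    (I′ ⊗ 1-q^ suc (N zero)) ⊗ Πqbinom n N ≈⟨ *-congʳ {Πqbinom n N} (inv1-poch-suc (N zero)) ⟩
    inv1 (poch (N zero)) ⊗ Πqbinom n N    ∎)
    where
    w  = 1-q^ suc (N (inject₁ (fromℕ n)) ∸ N (fromℕ (suc n)))
    I′ = inv1 (poch (suc (N zero)))

  1-q^-⊗ : ∀ d f → 1-q^ d ⊗ f ≈ f ⊕ ⊖ (qpow d ⊗ f)
  1-q^-⊗ d f = trans (distribʳ f 1ₛ (⊖ qpow d)) (+-cong (*-identityˡ f) (sym (-‿distribˡ-* (qpow d) f)))
    where open RingProperties ring using (-‿distribˡ-*)

module BoxSums {c ℓ} (R : CommutativeRing c ℓ) where
  open import Data.Vec.Functional using (_∷_)
  open PS R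
  open CommutativeRing R hiding (zero)
  open SeriesRing R using (Σ≤-cong; Σ≤-zero; Σ≤-+; Σ≤-head)
  open SetoidReasoning setoid

  boxSum-cong : ∀ n L m {f g : (Fin n → ℕ) → Series} → (∀ N → f N m ≈ g N m) → boxSum n L f m ≈ boxSum n L g m
  boxSum-cong zero    L m f≈g = f≈g _
  boxSum-cong (suc n) L m f≈g = Σ≤-cong L (λ j _ → boxSum-cong n L m (λ N → f≈g (j ∷ N)))

  boxSum-zero : ∀ n L m {f : (Fin n → ℕ) → Series} → (∀ N → f N m ≈ 0#) → boxSum n L f m ≈ 0#
  boxSum-zero zero    L m f≈0 = f≈0 _
  boxSum-zero (suc n) L m f≈0 = Σ≤-zero L (λ j _ → boxSum-zero n L m (λ N → f≈0 (j ∷ N)))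

  boxSum-⊕ : ∀ n L m (f g : (Fin n → ℕ) → Series) →
             boxSum n L (λ N → f N ⊕ g N) m ≈ boxSum n L f m + boxSum n L g m
  boxSum-⊕ zero    L m f g = refl
  boxSum-⊕ (suc n) L m f g =
    trans (Σ≤-cong L (λ j _ → boxSum-⊕ n L m (λ N → f (j ∷ N)) (λ N → g (j ∷ N)))) (Σ≤-+ L _ _)

  Σ≤-shift : ∀ L (H : ℕ → Carrier) → H 0 ≈ 0# → H (suc L) ≈ 0# → Σ≤ L (λ j → H (suc j)) ≈ Σ≤ L H
  Σ≤-shift L H H₀≈0 Hₗ≈0 = begin
    Σ≤ L (λ j → H (suc j))        ≈⟨ trans (+-congʳ H₀≈0) (+-identityˡ _) ⟨
    H 0 + Σ≤ L (λ j → H (suc j))  ≈⟨ Σ≤-head L H ⟨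
    Σ≤ L H + H (suc L)            ≈⟨ trans (+-congˡ Hₗ≈0) (+-identityʳ _) ⟩
    Σ≤ L H                        ∎

  Σ≤-shiftIf : ∀ L (H : ℕ → Carrier) c → (c ≡ true → H 0 ≈ 0# × H (suc L) ≈ 0#) →
               Σ≤ L (λ j → H (if c then suc j else j)) ≈ Σ≤ L H
  Σ≤-shiftIf L H true  vanish = Σ≤-shift L H (proj₁ (vanish ≡.refl)) (proj₂ (vanish ≡.refl))
  Σ≤-shiftIf L H false vanish = refl

  -- Incrementing the coordinates selected by s is a bijection from the box onto a shifted
  -- box; the two differ only in faces where the summand is assumed to vanish.
  boxSum-increment : ∀ n L m (s : Fin n → Bool) (f : (Fin n → ℕ) → Series) →
    (∀ N N′ → (∀ i → N i ≡ N′ i) → f N m ≈ f N′ m) →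
    (∀ N i → s i ≡ true → N i ≡ 0 ⊎ L < N i → f N m ≈ 0#) →
    boxSum n L (λ N → f (increment s N)) m ≈ boxSum n L f m
  boxSum-increment zero    L m s f f-resp vanish = f-resp _ _ (λ ())
  boxSum-increment (suc n) L m s f f-resp vanish = begin
    Σ≤ L (λ j → boxSum n L (λ N → f (increment s (j ∷ N))) m)
      ≈⟨ Σ≤-cong L (λ j _ → boxSum-cong n L m (λ N → f-resp _ _ (increment-∷ j N))) ⟩
    Σ≤ L (λ j → boxSum n L (λ N → f (bump j ∷ increment (λ i → s (suc i)) N)) m)
      ≈⟨ Σ≤-cong L (λ j _ → boxSum-increment n L m (λ i → s (suc i)) (λ N → f (bump j ∷ N))
           (λ N N′ N≡N′ → f-resp _ _ (λ { zero → ≡.refl ; (suc i) → N≡N′ i }))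
           (λ N i → vanish (bump j ∷ N) (suc i))) ⟩
    Σ≤ L (λ j → H (bump j))
      ≈⟨ Σ≤-shiftIf L H (s zero) (λ s₀ → boxSum-zero n L m (λ N → vanish (0 ∷ N) zero s₀ (inj₁ ≡.refl))
                                        , boxSum-zero n L m (λ N → vanish (suc L ∷ N) zero s₀ (inj₂ (ℕₚ.n<1+n L)))) ⟩
    Σ≤ L H
      ∎
    where
    bump : ℕ → ℕ
    bump j = if s zero then suc j else j
    H : ℕ → Carrier
    H x = boxSum n L (λ N → f (x ∷ N)) m
    increment-∷ : ∀ j N i → increment s (j ∷ N) i ≡ (bump j ∷ increment (λ i → s (suc i)) N) i
    increment-∷ j N zero    = ≡.refl
    increment-∷ j N (suc i) = ≡.refl

  IsSum-additive : ∀ n (f g h : (Fin n → ℕ) → Series) {S₁ S₂ S₃} →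
    IsSum n f S₁ → IsSum n g S₂ → IsSum n h S₃ →
    (∀ m L → m < L → boxSum n L f m ≈ boxSum n L g m + boxSum n L h m) →
    ∀ m → S₁ m ≈ S₂ m + S₃ m
  IsSum-additive n f g h {S₁} {S₂} {S₃} sum₁ sum₂ sum₃ split m
    with sum₁ m | sum₂ m | sum₃ m
  ... | B₁ , conv₁ | B₂ , conv₂ | B₃ , conv₃ = begin
    S₁ m                               ≈⟨ conv₁ L B₁≤L ⟨
    boxSum n L f m                     ≈⟨ split m L m<L ⟩
    boxSum n L g m + boxSum n L h m    ≈⟨ +-cong (conv₂ L B₂≤L) (conv₃ L B₃≤L) ⟩
    S₂ m + S₃ m                        ∎
    where
    L = B₁ ℕ.⊔ (B₂ ℕ.⊔ (B₃ ℕ.⊔ suc m))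
    B₁≤L : B₁ ≤ L
    B₁≤L = ℕₚ.m≤m⊔n B₁ _
    B₂≤L : B₂ ≤ L
    B₂≤L = ℕₚ.≤-trans (ℕₚ.m≤m⊔n B₂ _) (ℕₚ.m≤n⊔m B₁ _)
    B₃≤L : B₃ ≤ L
    B₃≤L = ℕₚ.≤-trans (ℕₚ.m≤m⊔n B₃ _) (ℕₚ.≤-trans (ℕₚ.m≤n⊔m B₂ _) (ℕₚ.m≤n⊔m B₁ _))
    m<L : m < L
    m<L = ℕₚ.≤-trans (ℕₚ.m≤n⊔m B₃ (suc m)) (ℕₚ.≤-trans (ℕₚ.m≤n⊔m B₂ _) (ℕₚ.m≤n⊔m B₁ _))

module Summands {c ℓ} (R : CommutativeRing c ℓ) (F : ℕ → PS.Series R) (b : ℕ) (k : Fin (suc b) → ℕ) where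
  open PS R
  open Terms R
  open SeriesRing R using (series)
  open Monomials R using (qpow-+; qpow-⊗-<)
  open QSeries R using (1-q^_; 1-q^-⊗; qbinom->; ΠFin-cong; ΠFin-zero; Πqbinom; weight; weight-shiftInit)
  open BoxSums R using (boxSum-cong; boxSum-⊕; boxSum-increment)
  open CommutativeRing series hiding (zero)
  open import Algebra.Properties.CommutativeSemigroup *-commutativeSemigroup using (x∙yz≈y∙xz)
  open import Algebra.Properties.Group +-group using (x≈y⇒x∙y⁻¹≈ε; //-rightDividesˡ)
  open RingProperties ring using (-‿distribʳ-*)
  module ℛ = CommutativeRing R
  module ℛG = Algebra.Properties.Group ℛ.+-group

  penult last : Fin (suc (suc b))
  penult = inject₁ (fromℕ b)
  last   = fromℕ (suc b)

  t : ℕ → ℕ → ℕ → (Fin (suc (suc b)) → ℕ) → Series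
  t = term F b k

  t-factor : ∀ e₀ e₁ e₂ N → t e₀ e₁ e₂ N ≈ qpow (expo b k e₀ e₁ e₂ N) ⊗ (F (N last) ⊗ weight b N)
  t-factor e₀ e₁ e₂ N = trans (*-assoc (qE ⊗ F (N last)) (inv1 (poch (N zero))) (Πqbinom b N))
                              (*-assoc qE (F (N last)) (weight b N))
    where qE = qpow (expo b k e₀ e₁ e₂ N)

  t-resp : ∀ e₀ e₁ e₂ {N N′} → (∀ i → N i ≡ N′ i) → t e₀ e₁ e₂ N ≈ t e₀ e₁ e₂ N′
  t-resp e₀ e₁ e₂ N≡N′ =
    *-cong (*-cong (*-cong (reflexive (≡.cong qpow (expo-cong b k e₀ e₁ e₂ N≡N′))) (reflexive (≡.cong F (N≡N′ last))))
                   (reflexive (≡.cong (λ n → inv1 (poch n)) (N≡N′ zero))))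
           (ΠFin-cong (suc b) (λ i → reflexive (≡.cong₂ qbinom (N≡N′ (inject₁ i)) (N≡N′ (suc i)))))

  t-ascent : ∀ e₀ e₁ e₂ N i → N (inject₁ i) < N (suc i) → t e₀ e₁ e₂ N ≈ 0ₛ
  t-ascent e₀ e₁ e₂ N i asc =
    trans (*-congˡ {X} (ΠFin-zero (suc b) (λ i → qbinom (N (inject₁ i)) (N (suc i))) i (qbinom-> asc))) (zeroʳ X)
    where X = qpow (expo b k e₀ e₁ e₂ N) ⊗ F (N last) ⊗ inv1 (poch (N zero))

  t-coeff-< : ∀ e₀ e₁ e₂ N {m L} i → m < L → L < N (inject₁ i) → t e₀ e₁ e₂ N m ℛ.≈ ℛ.0#
  t-coeff-< e₀ e₁ e₂ N {m} i m<L L<Nᵢ = ℛ.trans (t-factor e₀ e₁ e₂ N m)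
    (qpow-⊗-< (expo b k e₀ e₁ e₂ N) (F (N last) ⊗ weight b N) m
              (ℕₚ.<-≤-trans m<L (expo-≥ b k e₀ e₁ e₂ N i L<Nᵢ)))

  t001≈t010 : ∀ N → N penult ≤ N last → t 0 0 1 N ≈ t 0 1 0 N
  t001≈t010 N Nₚ≤Nₗ with ℕₚ.m≤n⇒m<n∨m≡n Nₚ≤Nₗ
  ... | inj₁ Nₚ<Nₗ = trans (t-ascent 0 0 1 N (fromℕ b) Nₚ<Nₗ) (sym (t-ascent 0 1 0 N (fromℕ b) Nₚ<Nₗ))
  ... | inj₂ Nₚ≡Nₗ = begin
    t 0 0 1 N                            ≈⟨ t-factor 0 0 1 N ⟩
    qpow (expo b k 0 0 1 N) ⊗ Y          ≡⟨ ≡.cong (λ e → qpow e ⊗ Y) same-expo ⟩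
    qpow (expo b k 0 1 0 N) ⊗ Y          ≈⟨ t-factor 0 1 0 N ⟨
    t 0 1 0 N                            ∎
    where
    open SetoidReasoning setoid
    Y = F (N last) ⊗ weight b N
    same-expo : expo b k 0 0 1 N ≡ expo b k 0 1 0 N
    same-expo = ≡.sym (≡.trans (expo-gap b k 0 N (ℕₚ.≤-reflexive (≡.sym Nₚ≡Nₗ)))
      (≡.trans (≡.cong (λ x → expo b k 0 0 1 N +ℕ (x ∸ N last)) Nₚ≡Nₗ)
               (≡.trans (≡.cong (expo b k 0 0 1 N +ℕ_) (ℕₚ.n∸n≡0 (N last))) (ℕₚ.+-identityʳ _))))

  Δ : (Fin (suc (suc b)) → ℕ) → Series
  Δ N = t 0 0 1 N ⊕ ⊖ t 0 1 0 N

  -- The two raised summands carry the exponents expo(1,1,1)(N) and expo(1,1,1)(N) + d.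
  Δ-shiftInit : ∀ N → Δ (shiftInit N) ≈ t 1 1 1 N
  Δ-shiftInit N with ℕₚ.≤-<-connex (N last) (N penult)
  ... | inj₂ Nₚ<Nₗ = trans (x≈y⇒x∙y⁻¹≈ε (t001≈t010 M Mₚ≤Mₗ)) (sym (t-ascent 1 1 1 N (fromℕ b) Nₚ<Nₗ))
    where
    M = shiftInit N
    Mₚ≤Mₗ : M penult ≤ M last
    Mₚ≤Mₗ = ≡.subst₂ _≤_ (≡.sym (shiftInit-inject₁ N (fromℕ b))) (≡.sym (shiftInit-fromℕ (suc b) N)) Nₚ<Nₗ
  ... | inj₁ Nₗ≤Nₚ = begin
    t 0 0 1 M ⊕ ⊖ t 0 1 0 M
      ≈⟨ +-cong (t-at-M 0 0 1 E (expo-shiftInit b k 0 0 1 N)) (-‿cong (t-at-M 0 1 0 (E +ℕ d) expo-gap-M)) ⟩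
    qpow E ⊗ Y ⊕ ⊖ (qpow (E +ℕ d) ⊗ Y)
      ≈⟨ +-congˡ (-‿cong (trans (*-congʳ {Y} (qpow-+ E d)) (*-assoc (qpow E) (qpow d) Y))) ⟩
    qpow E ⊗ Y ⊕ ⊖ (qpow E ⊗ (qpow d ⊗ Y))
      ≈⟨ +-congˡ (-‿distribʳ-* (qpow E) (qpow d ⊗ Y)) ⟩
    qpow E ⊗ Y ⊕ qpow E ⊗ ⊖ (qpow d ⊗ Y)
      ≈⟨ distribˡ (qpow E) Y (⊖ (qpow d ⊗ Y)) ⟨
    qpow E ⊗ (Y ⊕ ⊖ (qpow d ⊗ Y))
      ≈⟨ *-congˡ {qpow E} (1-q^-⊗ d Y) ⟨
    qpow E ⊗ (1-q^ d ⊗ (F (N last) ⊗ weight b M))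
      ≈⟨ *-congˡ {qpow E} (x∙yz≈y∙xz (1-q^ d) (F (N last)) (weight b M)) ⟩
    qpow E ⊗ (F (N last) ⊗ (1-q^ d ⊗ weight b M))
      ≈⟨ *-congˡ {qpow E} (*-congˡ {F (N last)} (weight-shiftInit b N Nₗ≤Nₚ)) ⟨
    qpow E ⊗ (F (N last) ⊗ weight b N)
      ≈⟨ t-factor 1 1 1 N ⟨
    t 1 1 1 N
      ∎
    where
    open SetoidReasoning setoid
    M = shiftInit N
    E = expo b k 1 1 1 N
    d = suc (N penult ∸ N last)
    Y = F (N last) ⊗ weight b M
    Mₗ≡Nₗ : M last ≡ N last
    Mₗ≡Nₗ = shiftInit-fromℕ (suc b) N
    Mₚ≡1+Nₚ : M penult ≡ suc (N penult)
    Mₚ≡1+Nₚ = shiftInit-inject₁ N (fromℕ b)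
    expo-gap-M : expo b k 0 1 0 M ≡ E +ℕ d
    expo-gap-M = ≡.trans
      (expo-gap b k 0 M (≡.subst₂ _≤_ (≡.sym Mₗ≡Nₗ) (≡.sym Mₚ≡1+Nₚ) (ℕₚ.m≤n⇒m≤1+n Nₗ≤Nₚ)))
      (≡.cong₂ _+ℕ_ (expo-shiftInit b k 0 0 1 N)
                    (≡.trans (≡.cong₂ _∸_ Mₚ≡1+Nₚ Mₗ≡Nₗ) (ℕₚ.+-∸-assoc 1 Nₗ≤Nₚ)))
    t-at-M : ∀ e₀ e₁ e₂ e → expo b k e₀ e₁ e₂ M ≡ e → t e₀ e₁ e₂ M ≈ qpow e ⊗ Y
    t-at-M e₀ e₁ e₂ e expo≡e = trans (t-factor e₀ e₁ e₂ M)
      (*-cong (reflexive (≡.cong qpow expo≡e)) (*-congʳ {weight b M} (reflexive (≡.cong F Mₗ≡Nₗ))))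

  Δ-face-inject₁ : ∀ N {m L} i → m < L → N (inject₁ i) ≡ 0 ⊎ L < N (inject₁ i) → Δ N m ℛ.≈ ℛ.0#
  Δ-face-inject₁ N i m<L (inj₂ L<Nᵢ) =
    ℛG.x≈y⇒x∙y⁻¹≈ε (ℛ.trans (t-coeff-< 0 0 1 N i m<L L<Nᵢ) (ℛ.sym (t-coeff-< 0 1 0 N i m<L L<Nᵢ)))
  Δ-face-inject₁ N {m} i m<L (inj₁ Nᵢ≡0) with ℕₚ.≤-<-connex (N penult) (N last)
  ... | inj₁ Nₚ≤Nₗ = x≈y⇒x∙y⁻¹≈ε (t001≈t010 N Nₚ≤Nₗ) m
  ... | inj₂ Nₗ<Nₚ with ascent b (λ j → N (inject₁ j)) i (≡.subst (_< N penult) (≡.sym Nᵢ≡0) (ℕₚ.≤-<-trans z≤n Nₗ<Nₚ))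
  ...   | j , asc =
    x≈y⇒x∙y⁻¹≈ε (trans (t-ascent 0 0 1 N (inject₁ j) asc) (sym (t-ascent 0 1 0 N (inject₁ j) asc))) m

  Δ-face : ∀ N {m L} i → m < L → notLast i ≡ true → N i ≡ 0 ⊎ L < N i → Δ N m ℛ.≈ ℛ.0#
  Δ-face N i m<L init face with notLast⇒inject₁ i init
  ... | j , ≡.refl = Δ-face-inject₁ N j m<L face

  boxSum-split : ∀ m L → m < L →
    boxSum (suc (suc b)) L (t 0 0 1) m ℛ.≈ boxSum (suc (suc b)) L (t 0 1 0) m ℛ.+ boxSum (suc (suc b)) L (t 1 1 1) m
  boxSum-split m L m<L = begin
    Σₗ (t 0 0 1)
      ≈⟨ boxSum-cong n L m {t 0 0 1} {λ N → Δ N ⊕ t 0 1 0 N}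
           (λ N → sym (//-rightDividesˡ (t 0 1 0 N) (t 0 0 1 N)) m) ⟩
    Σₗ (λ N → Δ N ⊕ t 0 1 0 N)
      ≈⟨ boxSum-⊕ n L m Δ (t 0 1 0) ⟩
    Σₗ Δ ℛ.+ Σₗ (t 0 1 0)
      ≈⟨ ℛ.+-congʳ (boxSum-increment n L m notLast Δ Δ-resp (λ N i → Δ-face N i m<L)) ⟨
    Σₗ (λ N → Δ (shiftInit N)) ℛ.+ Σₗ (t 0 1 0)
      ≈⟨ ℛ.+-congʳ (boxSum-cong n L m {λ N → Δ (shiftInit N)} {t 1 1 1} (λ N → Δ-shiftInit N m)) ⟩
    Σₗ (t 1 1 1) ℛ.+ Σₗ (t 0 1 0)
      ≈⟨ ℛ.+-comm _ _ ⟩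
    Σₗ (t 0 1 0) ℛ.+ Σₗ (t 1 1 1)
      ∎
    where
    open SetoidReasoning ℛ.setoid
    n = suc (suc b)
    Σₗ : ((Fin n → ℕ) → Series) → ℛ.Carrier
    Σₗ f = boxSum n L f m
    Δ-resp : ∀ N N′ → (∀ i → N i ≡ N′ i) → Δ N m ℛ.≈ Δ N′ m
    Δ-resp N N′ N≡N′ = ℛ.+-cong (t-resp 0 0 1 N≡N′ m) (ℛ.-‿cong (t-resp 0 1 0 N≡N′ m))

lemma5p8 : ∀ {c ℓ} (R : CommutativeRing c ℓ) (F : ℕ → PS.Series R) (b : ℕ) (k : Fin (suc b) → ℕ)
             (S₁ S₂ S₃ : PS.Series R) →
             PS.IsSum R (suc (suc b)) (Terms.term R F b k 0 0 1) S₁ →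
             PS.IsSum R (suc (suc b)) (Terms.term R F b k 0 1 0) S₂ →
             PS.IsSum R (suc (suc b)) (Terms.term R F b k 1 1 1) S₃ →
             ∀ n → CommutativeRing._≈_ R (S₁ n) (PS._⊕_ R S₂ S₃ n)
lemma5p8 R F b k S₁ S₂ S₃ sum₁ sum₂ sum₃ =
  IsSum-additive (suc (suc b)) (t 0 0 1) (t 0 1 0) (t 1 1 1) sum₁ sum₂ sum₃ boxSum-split
  where
  open BoxSums R using (IsSum-additive)
  open Summands R F b k using (t; boxSum-split)
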